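{- For $n\ge1$ let $\mathcal G_n(p)=G_{n,p}/(n\,(2n-1)!!)$, where $G_{n,p}$ is the number of configurations of size $n$ in which exactly $p$ other pairs contain the given pair. Then for every integer $m\ge0$, $$\sum_{p=0}^{n-1}\frac{p!}{(p-m)!}\,\mathcal G_n(p)=\frac{(n-1)!}{(n-m-1)!}\,\frac{m!}{(m+1)(2m+1)!!}.$$ In particular, if $G$ is a random variable with distribution $\mathcal G_n$, then $E(G)=(n-1)/6$ and $\mathrm{Var}(G)=(n-1)(3n+19)/180$.
   Context: Fix $n\ge1$. A configuration (of size $n$) is a perfect matching of the $2n$ points $1,2,\dots,2n$ (laid out on a line) into $n$ unordered pairs, together with one distinguished pair, called the given pair; the other $n-1$ pairs are treated as indistinguishable, so there are $n\,(2n-1)!!$ configurations. Let the given pair be $\{g<h\}$; another pair $\{a<b\}$ contains the given pair if $a<g<h<b$. Terms with $p<m$ in the sum are zero, and $\frac{(n-1)!}{(n-m-1)!}$ is interpreted as $0$ when $m>n-1$. -}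

module Defs where

open import Data.Nat using (ℕ; zero; suc; _+_; _*_; _∸_; _<?_; _≟_)
open import Data.List using (List; []; _∷_; [_]; map; concatMap; length; filter; upTo)
open import Data.Nat.ListAction using (sum)
open import Data.Product using (_×_; _,_; proj₁; proj₂)
open import Relation.Nullary.Decidable using (_×-dec_)

-- A pair {a < b}, stored as (a , b) with a < b.
Pair : Set
Pair = ℕ × ℕ

-- A perfect matching: a list of its pairs (order irrelevant; each set-matching
-- is generated exactly once below).
Matching : Set
Matching = List Pair

pick : {A : Set} → List A → List (A × List A)
pick [] = []
pick (x ∷ xs) = (x , xs) ∷ map (λ { (y , r) → (y , x ∷ r) }) (pick xs)

-- all perfect matchings of the points in the list (fuel = number of pairs).
-- The smallest remaining point is matched with one of the others; for an
-- increasingly sorted list every pair is stored as (smaller , larger).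
matchingsOf : ℕ → List ℕ → List Matching
matchingsOf _ [] = [ [] ]
matchingsOf zero (_ ∷ _) = []
matchingsOf (suc k) (x ∷ xs) =
  concatMap (λ { (y , rest) → map ((x , y) ∷_) (matchingsOf k rest) }) (pick xs)

points : ℕ → List ℕ
points n = map suc (upTo (2 * n))

matchings : ℕ → List Matching
matchings n = matchingsOf n (points n)

-- A configuration: the given pair together with the remaining n-1 pairs.
Configuration : Set
Configuration = Pair × List Pair

configurations : ℕ → List Configuration
configurations n = concatMap pick (matchings n)

containing : Configuration → ℕ
containing ((g , h) , others) =
  length (filter (λ { (a , b) → (a <? g) ×-dec (h <? b) }) others)

G : ℕ → ℕ → ℕ
G n p = length (filter (λ c → containing c ≟ p) (configurations n))

-- odd double factorial: dfact k = (2k-1)!!  (dfact 0 = 1)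
dfact : ℕ → ℕ
dfact zero = 1
dfact (suc k) = (2 * k + 1) * dfact k

-- falling factorial: falling p m = p!/(p-m)!, which is 0 when p < m
falling : ℕ → ℕ → ℕ
falling p zero = 1
falling zero (suc m) = 0
falling (suc p) (suc m) = suc p * falling p m

total : ℕ → ℕ
total n = n * dfact n

sumTo : ℕ → (ℕ → ℕ) → ℕ
sumTo n f = sum (map f (upTo n))

module Submission where

-- Write c⁽ᵐ⁾ for the falling factorial.  Fix 2k points and a point w among them,
-- with a points below w and b above.  Summing (number of pairs containing the
-- given pair)⁽ᵐ⁾ over the configurations whose given pair has upper endpoint w
-- gives C(a,m+1)·C(b,m)·m!²·(2(k-m-1)-1)!! (momentAt-formula).  This is proved by
-- induction on k, matching the lowest point x with a partner y: a new pair below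
-- the given pair contains it iff y lies above w, which shifts the falling factorial
-- by Pascal's rule (weight-cons), and the closed form satisfies the same recurrence
-- (formula-recurrence, a computation with binomial identities).  Summing over w
-- amounts to a Vandermonde convolution, giving C(2k,2m+2)·m!²·(2(k-m-1)-1)!!
-- (moment-formula), which is rewritten as k(2k-1)!!·(k-1)⁽ᵐ⁾·m!/((m+1)(2m+1)!!)
-- (moment-points).  Finally the sums defining G are the same moments grouped by
-- value (factorialMoment≡moment), and the mean and variance follow from the
-- cases m = 1, 2.

open import Defs
open import Data.Nat using (ℕ; zero; suc; _+_; _*_; _∸_; _^_; _≤_; _<_; _<ᵇ_; _≟_; _!; z≤n; s≤s; s<s; NonZero)
open import Data.Nat.Properties
open import Data.Nat.Combinatorics using (_C_; nCk+nC[k+1]≡[n+1]C[k+1]; nC1≡n; k>n⇒nCk≡0; nCk≡n!/k![n-k]!; k![n∸k]!∣n!)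
open import Data.Nat.DivMod using (m/n*n≡m)
open import Data.Nat.ListAction using (sum)
open import Data.Nat.Tactic.RingSolver using (solve-∀)
open import Data.List using (List; []; _∷_; map; concatMap; length; filter; upTo; _++_)
open import Data.List.Relation.Unary.All using (All; []; _∷_)
import Data.List.Relation.Unary.All as All
open import Data.List.Relation.Unary.All.Properties using (map⁺; concat⁺)
open import Data.List.Relation.Unary.AllPairs using (AllPairs; []; _∷_)
import Data.List.Relation.Unary.AllPairs.Properties as AllPairs
import Data.List.Properties as List
open import Algebra.Properties.CommutativeSemigroup +-commutativeSemigroup using () renaming (interchange to +-interchange)
open import Data.Product using (_×_; _,_; proj₁; proj₂)
open import Data.Sum using (_⊎_; inj₁; inj₂)
open import Data.Bool using (true; false; T)
open import Data.Unit using (tt)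
open import Data.Empty using (⊥-elim)
open import Relation.Nullary using (¬_; yes; no)
open import Relation.Binary using (tri<; tri≈; tri>)
open import Relation.Binary.PropositionalEquality

∑ : {A : Set} → List A → (A → ℕ) → ℕ
∑ [] f = 0
∑ (x ∷ xs) f = f x + ∑ xs f

module _ {A : Set} where

  ∑-++ : (xs ys : List A) (f : A → ℕ) → ∑ (xs ++ ys) f ≡ ∑ xs f + ∑ ys f
  ∑-++ [] ys f = refl
  ∑-++ (x ∷ xs) ys f = trans (cong (f x +_) (∑-++ xs ys f)) (sym (+-assoc (f x) _ _))

  ∑-congᴬ : {xs : List A} {f g : A → ℕ} → All (λ x → f x ≡ g x) xs → ∑ xs f ≡ ∑ xs g
  ∑-congᴬ [] = refl
  ∑-congᴬ (e ∷ es) = cong₂ _+_ e (∑-congᴬ es)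

  ∑-cong : (xs : List A) {f g : A → ℕ} → (∀ x → f x ≡ g x) → ∑ xs f ≡ ∑ xs g
  ∑-cong [] e = refl
  ∑-cong (x ∷ xs) e = cong₂ _+_ (e x) (∑-cong xs e)

  ∑-+ : (xs : List A) (f g : A → ℕ) → ∑ xs (λ x → f x + g x) ≡ ∑ xs f + ∑ xs g
  ∑-+ [] f g = refl
  ∑-+ (x ∷ xs) f g rewrite ∑-+ xs f g = +-interchange (f x) (g x) (∑ xs f) (∑ xs g)

  ∑-*ˡ : (xs : List A) (c : ℕ) (f : A → ℕ) → ∑ xs (λ x → c * f x) ≡ c * ∑ xs f
  ∑-*ˡ [] c f = sym (*-zeroʳ c)
  ∑-*ˡ (x ∷ xs) c f = trans (cong (c * f x +_) (∑-*ˡ xs c f)) (sym (*-distribˡ-+ c (f x) _))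

  ∑-*ʳ : (xs : List A) (f : A → ℕ) (c : ℕ) → ∑ xs (λ x → f x * c) ≡ ∑ xs f * c
  ∑-*ʳ xs f c = trans (∑-cong xs (λ x → *-comm (f x) c)) (trans (∑-*ˡ xs c f) (*-comm c _))

  ∑-const : (xs : List A) (c : ℕ) → ∑ xs (λ _ → c) ≡ length xs * c
  ∑-const [] c = refl
  ∑-const (x ∷ xs) c = cong (c +_) (∑-const xs c)

  ∑-zero : (xs : List A) → ∑ xs (λ _ → 0) ≡ 0
  ∑-zero xs = trans (∑-const xs 0) (*-zeroʳ (length xs))

  sum-map : (xs : List A) (f : A → ℕ) → sum (map f xs) ≡ ∑ xs f
  sum-map [] f = refl
  sum-map (x ∷ xs) f = cong (f x +_) (sum-map xs f)

module _ {A B : Set} where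

  ∑-map : (xs : List A) (g : A → B) (f : B → ℕ) → ∑ (map g xs) f ≡ ∑ xs (λ x → f (g x))
  ∑-map [] g f = refl
  ∑-map (x ∷ xs) g f = cong (f (g x) +_) (∑-map xs g f)

  ∑-concatMap : (xs : List A) (g : A → List B) (f : B → ℕ) →
    ∑ (concatMap g xs) f ≡ ∑ xs (λ x → ∑ (g x) f)
  ∑-concatMap [] g f = refl
  ∑-concatMap (x ∷ xs) g f = trans (∑-++ (g x) _ f) (cong (∑ (g x) f +_) (∑-concatMap xs g f))

  ∑-comm : (xs : List A) (ys : List B) (f : A → B → ℕ) →
    ∑ xs (λ x → ∑ ys (f x)) ≡ ∑ ys (λ y → ∑ xs (λ x → f x y))
  ∑-comm [] ys f = sym (∑-zero ys)
  ∑-comm (x ∷ xs) ys f = trans (cong (∑ ys (f x) +_) (∑-comm xs ys f)) (sym (∑-+ ys (f x) _))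

  length-concatMap : (xs : List A) (g : A → List B) → length (concatMap g xs) ≡ ∑ xs (λ x → length (g x))
  length-concatMap [] g = refl
  length-concatMap (x ∷ xs) g = trans (List.length-++ (g x)) (cong (length (g x) +_) (length-concatMap xs g))

𝟙< : ℕ → ℕ → ℕ
𝟙< _ zero = 0
𝟙< zero (suc _) = 1
𝟙< (suc y) (suc w) = 𝟙< y w

𝟙≡ : ℕ → ℕ → ℕ
𝟙≡ zero zero = 1
𝟙≡ zero (suc _) = 0
𝟙≡ (suc _) zero = 0
𝟙≡ (suc y) (suc w) = 𝟙≡ y w

𝟙<-yes : ∀ {y w} → y < w → 𝟙< y w ≡ 1
𝟙<-yes {zero} {suc w} _ = refl
𝟙<-yes {suc y} {suc w} (s≤s y<w) = 𝟙<-yes y<w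

𝟙<-no : ∀ {y w} → w ≤ y → 𝟙< y w ≡ 0
𝟙<-no {_} {zero} _ = refl
𝟙<-no {suc y} {suc w} (s≤s w≤y) = 𝟙<-no w≤y

𝟙<-bit : ∀ y w → 𝟙< y w ≡ 0 ⊎ 𝟙< y w ≡ 1
𝟙<-bit _ zero = inj₁ refl
𝟙<-bit zero (suc w) = inj₂ refl
𝟙<-bit (suc y) (suc w) = 𝟙<-bit y w

𝟙≡-refl : ∀ y → 𝟙≡ y y ≡ 1
𝟙≡-refl zero = refl
𝟙≡-refl (suc y) = 𝟙≡-refl y

𝟙≡-no : ∀ {y w} → ¬ y ≡ w → 𝟙≡ y w ≡ 0
𝟙≡-no {zero} {zero} y≢w = ⊥-elim (y≢w refl)
𝟙≡-no {zero} {suc w} _ = refl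
𝟙≡-no {suc y} {zero} _ = refl
𝟙≡-no {suc y} {suc w} y≢w = 𝟙≡-no (λ e → y≢w (cong suc e))

𝟙≡-sym : ∀ y w → 𝟙≡ y w ≡ 𝟙≡ w y
𝟙≡-sym zero zero = refl
𝟙≡-sym zero (suc w) = refl
𝟙≡-sym (suc y) zero = refl
𝟙≡-sym (suc y) (suc w) = 𝟙≡-sym y w

𝟙≡-subst : ∀ h w (f : ℕ → ℕ) → 𝟙≡ h w * f h ≡ 𝟙≡ h w * f w
𝟙≡-subst h w f with h ≟ w
... | yes refl = refl
... | no h≢w rewrite 𝟙≡-no h≢w = refl

-- Δ m f = m · f (m - 1): the coefficient by which a factorial moment of order m
-- changes when the underlying count grows by one (see falling-pascal).
Δ : ℕ → (ℕ → ℕ) → ℕ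
Δ zero f = 0
Δ (suc m) f = suc m * f m

Δ-cong : ∀ m {f g : ℕ → ℕ} → (∀ i → f i ≡ g i) → Δ m f ≡ Δ m g
Δ-cong zero e = refl
Δ-cong (suc m) e = cong (suc m *_) (e m)

Δ-*ˡ : ∀ m c f → Δ m (λ i → c * f i) ≡ c * Δ m f
Δ-*ˡ zero c f = sym (*-zeroʳ c)
Δ-*ˡ (suc m) c f = x∙yz≡y∙xz (suc m) c (f m)
  where
  x∙yz≡y∙xz : ∀ a b c → a * (b * c) ≡ b * (a * c)
  x∙yz≡y∙xz = solve-∀

∑-Δ : {A : Set} (xs : List A) (f : A → ℕ → ℕ) (m : ℕ) → ∑ xs (λ x → Δ m (f x)) ≡ Δ m (λ i → ∑ xs (λ x → f x i))
∑-Δ xs f zero = ∑-zero xs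
∑-Δ xs f (suc m) = ∑-*ˡ xs (suc m) (λ x → f x m)

-- c⁽ᵐ⁺¹⁾ = (c - m) c⁽ᵐ⁾, written without subtraction.
falling-suc : ∀ c m → falling c (suc m) + m * falling c m ≡ c * falling c m
falling-suc zero zero = refl
falling-suc zero (suc m) = *-zeroʳ m
falling-suc (suc c) zero = +-identityʳ _
falling-suc (suc c) (suc m) =
  begin
    suc c * falling c (suc m) + suc m * (suc c * falling c m)
  ≡⟨ regroup c (falling c (suc m)) m (falling c m) ⟩
    suc c * (falling c (suc m) + m * falling c m) + suc c * falling c m
  ≡⟨ cong (λ z → suc c * z + suc c * falling c m) (falling-suc c m) ⟩
    suc c * (c * falling c m) + suc c * falling c m
  ≡⟨ collect c (falling c m) ⟩
    suc c * (suc c * falling c m)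
  ∎
  where
  open ≡-Reasoning
  regroup : ∀ c F₁ m F₀ → suc c * F₁ + suc m * (suc c * F₀) ≡ suc c * (F₁ + m * F₀) + suc c * F₀
  regroup = solve-∀
  collect : ∀ c F₀ → suc c * (c * F₀) + suc c * F₀ ≡ suc c * (suc c * F₀)
  collect = solve-∀

falling-pascal : ∀ c m → falling (suc c) m ≡ falling c m + Δ m (falling c)
falling-pascal c zero = refl
falling-pascal c (suc m) =
  begin
    suc c * falling c m
  ≡⟨ +-comm (falling c m) (c * falling c m) ⟩
    c * falling c m + falling c m
  ≡⟨ cong (_+ falling c m) (sym (falling-suc c m)) ⟩
    falling c (suc m) + m * falling c m + falling c m
  ≡⟨ collect (falling c (suc m)) m (falling c m) ⟩
    falling c (suc m) + suc m * falling c m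
  ∎
  where
  open ≡-Reasoning
  collect : ∀ a m b → a + m * b + b ≡ a + suc m * b
  collect = solve-∀

falling-bump : ∀ e c m → e ≡ 0 ⊎ e ≡ 1 → falling (e + c) m ≡ falling c m + e * Δ m (falling c)
falling-bump .0 c m (inj₁ refl) = sym (+-identityʳ (falling c m))
falling-bump .1 c m (inj₂ refl) = trans (falling-pascal c m) (cong (falling c m +_) (sym (+-identityʳ _)))

falling-one : ∀ p → falling p 1 ≡ p
falling-one zero = refl
falling-one (suc p) = *-identityʳ (suc p)

falling-two : ∀ p → falling p 2 + falling p 1 ≡ p * p
falling-two zero = refl
falling-two (suc p) = trans (cong (λ z → suc p * z + suc p * 1) (falling-one p)) (expand p)
  where
  expand : ∀ p → suc p * p + suc p * 1 ≡ suc p * suc p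
  expand = solve-∀

pascal : ∀ n k → suc n C suc k ≡ n C k + n C suc k
pascal n k = sym (nCk+nC[k+1]≡[n+1]C[k+1] n k)

binom-step : ∀ n r → r * (n C r) + suc r * (n C suc r) ≡ n * (n C r)
binom-step zero zero = refl
binom-step zero (suc r) = cong₂ _+_ (vanish (suc r)) (vanish (suc (suc r)))
  where
  vanish : ∀ s → s * (0 C s) ≡ 0
  vanish zero = refl
  vanish (suc s) = *-zeroʳ (suc s)
binom-step (suc n) zero = trans (+-identityʳ _) (trans (nC1≡n (suc n)) (sym (*-identityʳ (suc n))))
binom-step (suc n) (suc r) =
  begin
    suc r * (suc n C suc r) + suc (suc r) * (suc n C suc (suc r))
  ≡⟨ cong₂ (λ u v → suc r * u + suc (suc r) * v) (pascal n r) (pascal n (suc r)) ⟩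
    suc r * (a + b) + suc (suc r) * (b + c)
  ≡⟨ regroup r a b c ⟩
    (r * a + suc r * b) + (suc r * b + suc (suc r) * c) + (a + b)
  ≡⟨ cong₂ (λ u v → u + v + (a + b)) (binom-step n r) (binom-step n (suc r)) ⟩
    n * a + n * b + (a + b)
  ≡⟨ collect n a b ⟩
    suc n * (a + b)
  ≡⟨ cong (suc n *_) (sym (pascal n r)) ⟩
    suc n * (suc n C suc r)
  ∎
  where
  open ≡-Reasoning
  a = n C r
  b = n C suc r
  c = n C suc (suc r)
  regroup : ∀ r a b c → suc r * (a + b) + suc (suc r) * (b + c)
                        ≡ (r * a + suc r * b) + (suc r * b + suc (suc r) * c) + (a + b)
  regroup = solve-∀
  collect : ∀ n a b → n * a + n * b + (a + b) ≡ suc n * (a + b)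
  collect = solve-∀

binom-absorb : ∀ n k → suc n * (n C k) ≡ suc k * (suc n C suc k)
binom-absorb n k =
  begin
    suc n * (n C k)
  ≡⟨ cong (n C k +_) (sym (binom-step n k)) ⟩
    n C k + (k * (n C k) + suc k * (n C suc k))
  ≡⟨ collect (n C k) k (n C suc k) ⟩
    suc k * (n C k + n C suc k)
  ≡⟨ cong (suc k *_) (sym (pascal n k)) ⟩
    suc k * (suc n C suc k)
  ∎
  where
  open ≡-Reasoning
  collect : ∀ a k b → a + (k * a + suc k * b) ≡ suc k * (a + b)
  collect = solve-∀

binom-pred : ∀ n r → n * ((n ∸ 1) C r) + r * (n C r) ≡ n * (n C r)
binom-pred zero zero = refl
binom-pred zero (suc r) = *-zeroʳ (suc r)
binom-pred (suc n) zero = +-identityʳ _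
binom-pred (suc n) (suc r) =
  begin
    suc n * (n C suc r) + suc r * (suc n C suc r)
  ≡⟨ cong (_+ suc r * (suc n C suc r)) (binom-absorb n (suc r)) ⟩
    suc (suc r) * (suc n C suc (suc r)) + suc r * (suc n C suc r)
  ≡⟨ +-comm _ (suc r * (suc n C suc r)) ⟩
    suc r * (suc n C suc r) + suc (suc r) * (suc n C suc (suc r))
  ≡⟨ binom-step (suc n) (suc r) ⟩
    suc n * (suc n C suc r)
  ∎
  where open ≡-Reasoning

binom-factorials : ∀ {n k} → k ≤ n → (n C k) * (k ! * (n ∸ k) !) ≡ n !
binom-factorials {n} {k} k≤n =
  trans (cong (_* (k ! * (n ∸ k) !)) (nCk≡n!/k![n-k]! k≤n))
        (m/n*n≡m {{k !* (n ∸ k) !≢0}} (k![n∸k]!∣n! k≤n))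

falling≡!*C : ∀ n r → r ! * (n C r) ≡ falling n r
falling≡!*C n zero = refl
falling≡!*C zero (suc r) = *-zeroʳ (suc r !)
falling≡!*C (suc n) (suc r) =
  begin
    suc r * r ! * (suc n C suc r)
  ≡⟨ reorder (suc r) (r !) (suc n C suc r) ⟩
    r ! * (suc r * (suc n C suc r))
  ≡⟨ cong (r ! *_) (sym (binom-absorb n r)) ⟩
    r ! * (suc n * (n C r))
  ≡⟨ x∙yz≡y∙xz (r !) (suc n) (n C r) ⟩
    suc n * (r ! * (n C r))
  ≡⟨ cong (suc n *_) (falling≡!*C n r) ⟩
    suc n * falling n r
  ∎
  where
  open ≡-Reasoning
  reorder : ∀ a b c → a * b * c ≡ b * (a * c)
  reorder = solve-∀
  x∙yz≡y∙xz : ∀ a b c → a * (b * c) ≡ b * (a * c)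
  x∙yz≡y∙xz = solve-∀

binom-factorials-+ : ∀ a b → ((a + b) C a) * (a ! * b !) ≡ (a + b) !
binom-factorials-+ a b =
  trans (cong (λ d → ((a + b) C a) * (a ! * d !)) (sym (m+n∸m≡n a b))) (binom-factorials (m≤m+n a b))

factorial-even : ∀ j → (2 * j) ! ≡ 2 ^ j * j ! * dfact j
factorial-even zero = refl
factorial-even (suc j) =
  begin
    (2 * suc j) !
  ≡⟨ cong _! (double-suc j) ⟩
    suc (suc (2 * j)) * (suc (2 * j) * (2 * j) !)
  ≡⟨ cong (λ z → suc (suc (2 * j)) * (suc (2 * j) * z)) (factorial-even j) ⟩
    suc (suc (2 * j)) * (suc (2 * j) * (2 ^ j * j ! * dfact j))
  ≡⟨ regroup j (2 ^ j) (j !) (dfact j) ⟩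
    2 ^ suc j * suc j ! * dfact (suc j)
  ∎
  where
  open ≡-Reasoning
  double-suc : ∀ j → 2 * suc j ≡ suc (suc (2 * j))
  double-suc = solve-∀
  regroup : ∀ j p f d → suc (suc (2 * j)) * (suc (2 * j) * (p * f * d)) ≡ 2 * p * (suc j * f) * ((2 * j + 1) * d)
  regroup = solve-∀

binom-double : ∀ n r → ((2 * n) C (2 * r)) * dfact r * dfact (n ∸ r) ≡ (n C r) * dfact n
binom-double n r with ≤-<-connex r n
... | inj₂ n<r rewrite k>n⇒nCk≡0 (*-monoʳ-< 2 n<r) | k>n⇒nCk≡0 n<r = refl
... | inj₁ r≤n with m≤n⇒∃[o]m+o≡n r≤n
... | s , refl =
  trans (cong (λ d → ((2 * (r + s)) C (2 * r)) * dfact r * dfact d) (m+n∸m≡n r s))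
        (*-cancelʳ-≡ _ _ K {{K≢0}} scaled)
  where
  open ≡-Reasoning
  K = 2 ^ (r + s) * r ! * s !
  K≢0 : NonZero K
  K≢0 = m*n≢0 (2 ^ (r + s) * r !) (s !) {{m*n≢0 (2 ^ (r + s)) (r !) {{m^n≢0 2 (r + s)}} {{r !≢0}}}} {{s !≢0}}
  scaled : ((2 * (r + s)) C (2 * r)) * dfact r * dfact s * K ≡ ((r + s) C r) * dfact (r + s) * K
  scaled =
    begin
      ((2 * (r + s)) C (2 * r)) * dfact r * dfact s * (2 ^ (r + s) * r ! * s !)
    ≡⟨ cong₂ (λ u v → (u C (2 * r)) * dfact r * dfact s * (v * r ! * s !)) (*-distribˡ-+ 2 r s) (^-distribˡ-+-* 2 r s) ⟩
      ((2 * r + 2 * s) C (2 * r)) * dfact r * dfact s * (2 ^ r * 2 ^ s * r ! * s !)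
    ≡⟨ regroup ((2 * r + 2 * s) C (2 * r)) (dfact r) (dfact s) (2 ^ r) (2 ^ s) (r !) (s !) ⟩
      ((2 * r + 2 * s) C (2 * r)) * ((2 ^ r * r ! * dfact r) * (2 ^ s * s ! * dfact s))
    ≡⟨ cong₂ (λ u v → ((2 * r + 2 * s) C (2 * r)) * (u * v)) (sym (factorial-even r)) (sym (factorial-even s)) ⟩
      ((2 * r + 2 * s) C (2 * r)) * ((2 * r) ! * (2 * s) !)
    ≡⟨ binom-factorials-+ (2 * r) (2 * s) ⟩
      (2 * r + 2 * s) !
    ≡⟨ cong _! (sym (*-distribˡ-+ 2 r s)) ⟩
      (2 * (r + s)) !
    ≡⟨ factorial-even (r + s) ⟩
      2 ^ (r + s) * (r + s) ! * dfact (r + s)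
    ≡⟨ cong (λ z → 2 ^ (r + s) * z * dfact (r + s)) (sym (binom-factorials-+ r s)) ⟩
      2 ^ (r + s) * (((r + s) C r) * (r ! * s !)) * dfact (r + s)
    ≡⟨ reorder (2 ^ (r + s)) ((r + s) C r) (r !) (s !) (dfact (r + s)) ⟩
      ((r + s) C r) * dfact (r + s) * (2 ^ (r + s) * r ! * s !)
    ∎
    where
    regroup : ∀ c dr ds pr ps fr fs → c * dr * ds * (pr * ps * fr * fs) ≡ c * ((pr * fr * dr) * (ps * fs * ds))
    regroup = solve-∀
    reorder : ∀ p c fr fs d → p * (c * (fr * fs)) * d ≡ c * d * (p * fr * fs)
    reorder = solve-∀

-- ∑⟨ N ⟩ f is the sum of f a b over a + b = N.
∑⟨_⟩ : ℕ → (ℕ → ℕ → ℕ) → ℕ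
∑⟨ zero ⟩ f = f 0 0
∑⟨ suc N ⟩ f = f 0 (suc N) + ∑⟨ N ⟩ (λ a b → f (suc a) b)

∑⟨⟩-cong : ∀ N {f g : ℕ → ℕ → ℕ} → (∀ a b → f a b ≡ g a b) → ∑⟨ N ⟩ f ≡ ∑⟨ N ⟩ g
∑⟨⟩-cong zero e = e 0 0
∑⟨⟩-cong (suc N) e = cong₂ _+_ (e 0 (suc N)) (∑⟨⟩-cong N (λ a b → e (suc a) b))

∑⟨⟩-+ : ∀ N (f g : ℕ → ℕ → ℕ) → ∑⟨ N ⟩ (λ a b → f a b + g a b) ≡ ∑⟨ N ⟩ f + ∑⟨ N ⟩ g
∑⟨⟩-+ zero f g = refl
∑⟨⟩-+ (suc N) f g rewrite ∑⟨⟩-+ N (λ a b → f (suc a) b) (λ a b → g (suc a) b) =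
  +-interchange (f 0 (suc N)) (g 0 (suc N)) _ _

∑⟨⟩-*ʳ : ∀ N (f : ℕ → ℕ → ℕ) c → ∑⟨ N ⟩ (λ a b → f a b * c) ≡ ∑⟨ N ⟩ f * c
∑⟨⟩-*ʳ zero f c = refl
∑⟨⟩-*ʳ (suc N) f c =
  trans (cong (f 0 (suc N) * c +_) (∑⟨⟩-*ʳ N (λ a b → f (suc a) b) c)) (sym (*-distribʳ-+ c (f 0 (suc N)) _))

vandermonde-upper₀ : ∀ N q → ∑⟨ N ⟩ (λ a b → (a C 0) * (b C q)) ≡ suc N C suc q
vandermonde-upper₀ zero zero = refl
vandermonde-upper₀ zero (suc q) = refl
vandermonde-upper₀ (suc N) q =
  trans (cong₂ _+_ (*-identityˡ (suc N C q)) (vandermonde-upper₀ N q)) (sym (pascal (suc N) q))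

vandermonde-upper : ∀ N p q → ∑⟨ N ⟩ (λ a b → (a C p) * (b C q)) ≡ suc N C suc (p + q)
vandermonde-upper N zero q = vandermonde-upper₀ N q
vandermonde-upper zero (suc p) q = refl
vandermonde-upper (suc N) (suc p) q =
  begin
    ∑⟨ N ⟩ (λ a b → (suc a C suc p) * (b C q))
  ≡⟨ ∑⟨⟩-cong N (λ a b → trans (cong (_* (b C q)) (pascal a p)) (*-distribʳ-+ (b C q) (a C p) (a C suc p))) ⟩
    ∑⟨ N ⟩ (λ a b → (a C p) * (b C q) + (a C suc p) * (b C q))
  ≡⟨ ∑⟨⟩-+ N _ _ ⟩
    ∑⟨ N ⟩ (λ a b → (a C p) * (b C q)) + ∑⟨ N ⟩ (λ a b → (a C suc p) * (b C q))
  ≡⟨ cong₂ _+_ (vandermonde-upper N p q) (vandermonde-upper N (suc p) q) ⟩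
    suc N C suc (p + q) + suc N C suc (suc p + q)
  ≡⟨ sym (pascal (suc N) (suc (p + q))) ⟩
    suc (suc N) C suc (suc p + q)
  ∎
  where open ≡-Reasoning

Increasing : List ℕ → Set
Increasing = AllPairs _<_

Both : (ℕ → Set) → Pair → Set
Both P (a , b) = P a × P b

concatMap-All : {A B : Set} {P : B → Set} (xs : List A) (g : A → List B) →
  All (λ x → All P (g x)) xs → All P (concatMap g xs)
concatMap-All xs g all = concat⁺ (map⁺ all)

pick-All : {A : Set} {P : A → Set} (xs : List A) → All P xs →
  All (λ yr → P (proj₁ yr) × All P (proj₂ yr)) (pick xs)
pick-All [] [] = []
pick-All (x ∷ xs) (px ∷ pxs) =
  (px , pxs) ∷ map⁺ (All.map (λ { {(y , r)} (py , pr) → py , (px ∷ pr) }) (pick-All xs pxs))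

pick-Increasing : ∀ xs → Increasing xs → All (λ yr → Increasing (proj₂ yr)) (pick xs)
pick-Increasing [] _ = []
pick-Increasing (x ∷ xs) (x<xs ∷ inc) =
  inc ∷ map⁺ (All.map (λ { {(y , r)} ((_ , x<r) , inc-r) → x<r ∷ inc-r })
                      (All.zip (pick-All xs x<xs , pick-Increasing xs inc)))

pick-length : {A : Set} (xs : List A) → All (λ yr → suc (length (proj₂ yr)) ≡ length xs) (pick xs)
pick-length [] = []
pick-length (x ∷ xs) = refl ∷ map⁺ (All.map (λ { {(y , r)} e → cong suc e }) (pick-length xs))

length-pick : {A : Set} (xs : List A) → length (pick xs) ≡ length xs
length-pick [] = refl
length-pick (x ∷ xs) = cong suc (trans (List.length-map _ (pick xs)) (length-pick xs))

matchingsOf-All : {P : ℕ → Set} (k : ℕ) (L : List ℕ) → All P L → All (All (Both P)) (matchingsOf k L)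
matchingsOf-All _ [] _ = [] ∷ []
matchingsOf-All zero (_ ∷ _) _ = []
matchingsOf-All (suc k) (x ∷ xs) (px ∷ pxs) = concatMap-All (pick xs) _
  (All.map (λ { {(y , rest)} (py , pr) → map⁺ (All.map ((px , py) ∷_) (matchingsOf-All k rest pr)) })
           (pick-All xs pxs))

matchingsOf-size : ∀ k L → All (λ M → length M ≤ k) (matchingsOf k L)
matchingsOf-size k [] = z≤n ∷ []
matchingsOf-size zero (_ ∷ _) = []
matchingsOf-size (suc k) (x ∷ xs) = concatMap-All (pick xs) _
  (All.universal (λ { (y , rest) → map⁺ (All.map s≤s (matchingsOf-size k rest)) }) (pick xs))

odd-rest : ∀ k n → suc n ≡ 2 * suc k → n ≡ suc (2 * k)
odd-rest k n e = suc-injective (trans e (double-suc k))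
  where
  double-suc : ∀ k → 2 * suc k ≡ suc (suc (2 * k))
  double-suc = solve-∀

length-matchingsOf : ∀ k L → length L ≡ 2 * k → length (matchingsOf k L) ≡ dfact k
length-matchingsOf zero [] _ = refl
length-matchingsOf zero (x ∷ L) ()
length-matchingsOf (suc k) [] ()
length-matchingsOf (suc k) (x ∷ xs) len =
  begin
    length (concatMap _ (pick xs))
  ≡⟨ length-concatMap (pick xs) _ ⟩
    ∑ (pick xs) (λ yr → length (map ((x , proj₁ yr) ∷_) (matchingsOf k (proj₂ yr))))
  ≡⟨ ∑-congᴬ (All.map (λ { {(y , r)} len-r →
        trans (List.length-map _ (matchingsOf k r)) (length-matchingsOf k r (suc-injective (trans len-r len-xs))) })
        (pick-length xs)) ⟩
    ∑ (pick xs) (λ _ → dfact k)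
  ≡⟨ ∑-const (pick xs) (dfact k) ⟩
    length (pick xs) * dfact k
  ≡⟨ cong (_* dfact k) (trans (length-pick xs) (trans len-xs (+-comm 1 (2 * k)))) ⟩
    (2 * k + 1) * dfact k
  ∎
  where
  open ≡-Reasoning
  len-xs : length xs ≡ suc (2 * k)
  len-xs = odd-rest k (length xs) len

configurationsOf : ℕ → List ℕ → List Configuration
configurationsOf k L = concatMap pick (matchingsOf k L)

upper : Configuration → ℕ
upper ((g , h) , _) = h

configurationsOf-upper : ∀ {P : ℕ → Set} k L → All P L → All (λ c → P (upper c)) (configurationsOf k L)
configurationsOf-upper k L all = concatMap-All (matchingsOf k L) pick
  (All.map (λ {M} all-M → All.map (λ { {((g , h) , r)} ((_ , ph) , _) → ph }) (pick-All M all-M))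
           (matchingsOf-All k L all))

containing-bound : ∀ k L → All (λ c → containing c < k) (configurationsOf k L)
containing-bound k L = concatMap-All (matchingsOf k L) pick
  (All.map (λ {M} size-M → All.map (λ { {((g , h) , r)} len-r →
                ≤-trans (s≤s (List.length-filter _ r)) (≤-trans (≤-reflexive len-r) size-M) })
              (pick-length M))
           (matchingsOf-size k L))

-- containing counts with a filter whose test computes through _<ᵇ_, so the next two
-- lemmas case on those booleans.

containing-min : ∀ x y R → All (Both (x <_)) R → containing ((x , y) , R) ≡ 0
containing-min x y [] [] = refl
containing-min x y ((a , b) ∷ R) ((x<a , _) ∷ rest) with a <ᵇ x in a<ᵇx
... | true = ⊥-elim (<-asym x<a (<ᵇ⇒< a x (subst T (sym a<ᵇx) tt)))
... | false = containing-min x y R rest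

containing-cons : ∀ g h x y r → x < g →
  containing ((g , h) , (x , y) ∷ r) ≡ 𝟙< h y + containing ((g , h) , r)
containing-cons g h x y r x<g with x <ᵇ g in x<ᵇg | h <ᵇ y in h<ᵇy
... | false | _ = ⊥-elim (subst T x<ᵇg (<⇒<ᵇ x<g))
... | true | true = cong (_+ containing ((g , h) , r)) (sym (𝟙<-yes (<ᵇ⇒< h y (subst T (sym h<ᵇy) tt))))
... | true | false = cong (_+ containing ((g , h) , r)) (sym (𝟙<-no {h} {y} (≮⇒≥ (λ h<y → subst T h<ᵇy (<⇒<ᵇ h<y)))))

-- For a matching of 2k
-- points in which a points lie below a point w and b above it, this is the sum of
-- the m-th falling factorial of the number of pairs containing the given pair,
-- over the configurations whose given pair has upper endpoint w.
formula : ℕ → ℕ → ℕ → ℕ → ℕ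
formula k a b m = (a C suc m) * (b C m) * (m ! * m !) * dfact (k ∸ suc m)

too-many-pairs : ∀ S P k m → k ≤ m → S + suc (2 * m) * P ≡ 2 * k * P → P ≡ 0 × S ≡ 0
too-many-pairs S zero k m k≤m e =
  refl , trans (sym (+-identityʳ S)) (trans (cong (S +_) (sym (*-zeroʳ (suc (2 * m))))) (trans e (*-zeroʳ (2 * k))))
too-many-pairs S (suc p) k m k≤m e = ⊥-elim (<-irrefl refl (≤-trans (s≤s (m≤n+m X p)) impossible))
  where
  X = 2 * m * suc p
  impossible : suc p + X ≤ X
  impossible = begin
    suc (2 * m) * suc p      ≤⟨ m≤n+m _ S ⟩
    S + suc (2 * m) * suc p  ≡⟨ e ⟩
    2 * k * suc p            ≤⟨ *-monoˡ-≤ (suc p) (*-monoʳ-≤ 2 k≤m) ⟩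
    X                        ∎
    where open ≤-Reasoning

-- The part of formula (suc k) (suc A) B m coming from C(A,m) in Pascal's rule
-- C(A+1,m+1) = C(A,m) + C(A,m+1).
formula-diagonal : ∀ k A B m →
  (A C m) * (B C m) * (m ! * m !) * dfact (k ∸ m) ≡ falling 0 m * dfact k + B * Δ m (formula k A (B ∸ 1))
formula-diagonal k A B zero = expand (dfact k) B
  where
  expand : ∀ d B → 1 * 1 * (1 * 1) * d ≡ 1 * d + B * 0
  expand = solve-∀
formula-diagonal k A zero (suc m) =
  vanish (A C suc m) (suc m * m ! * (suc m * m !)) (dfact (k ∸ suc m)) (dfact k)
  where
  vanish : ∀ a b c d → a * 0 * b * c ≡ 0 * d + 0 * 0
  vanish = solve-∀
formula-diagonal k A (suc B) (suc m) =
  begin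
    CA * (suc B C suc m) * (suc m * f * (suc m * f)) * D
  ≡⟨ reorder CA (suc B C suc m) (suc m) f D ⟩
    suc m * CA * (f * f) * D * (suc m * (suc B C suc m))
  ≡⟨ cong (λ z → suc m * CA * (f * f) * D * z) (sym (binom-absorb B m)) ⟩
    suc m * CA * (f * f) * D * (suc B * (B C m))
  ≡⟨ regroup (suc m) CA f D (suc B) (B C m) (dfact k) ⟩
    0 * dfact k + suc B * (suc m * (CA * (B C m) * (f * f) * D))
  ∎
  where
  open ≡-Reasoning
  CA = A C suc m
  f = m !
  D = dfact (k ∸ suc m)
  reorder : ∀ a c s f D → a * c * (s * f * (s * f)) * D ≡ s * a * (f * f) * D * (s * c)
  reorder = solve-∀
  regroup : ∀ s a f D b c d → s * a * (f * f) * D * (b * c) ≡ 0 * d + b * (s * (a * c * (f * f) * D))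
  regroup = solve-∀

-- The part coming from C(A,m+1).  Here A + B = 2k counts the points other than the
-- lowest point and w.
module OffDiagonal (k A B m : ℕ) (A+B≡2k : A + B ≡ 2 * k) where
  open ≡-Reasoning

  P S : ℕ
  P = (A C suc m) * (B C m)
  S = A * ((A ∸ 1) C suc m) * (B C m) + B * ((B ∸ 1) C m) * (A C suc m)

  -- S + (2m+1)·P = 2k·P, i.e. S = (2(k-m-1)+1)·P when m < k.
  S-balance : S + suc (2 * m) * P ≡ 2 * k * P
  S-balance =
    begin
      S + suc (2 * m) * P
    ≡⟨ regroup (A * ((A ∸ 1) C suc m)) (A C suc m) (B C m) (B * ((B ∸ 1) C m)) m ⟩
      (A * ((A ∸ 1) C suc m) + suc m * (A C suc m)) * (B C m) + (B * ((B ∸ 1) C m) + m * (B C m)) * (A C suc m)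
    ≡⟨ cong₂ (λ u v → u * (B C m) + v * (A C suc m)) (binom-pred A (suc m)) (binom-pred B m) ⟩
      A * (A C suc m) * (B C m) + B * (B C m) * (A C suc m)
    ≡⟨ collect A (A C suc m) (B C m) B ⟩
      (A + B) * P
    ≡⟨ cong (_* P) A+B≡2k ⟩
      2 * k * P
    ∎
    where
    regroup : ∀ x a c y m → x * c + y * a + suc (2 * m) * (a * c) ≡ (x + suc m * a) * c + (y + m * c) * a
    regroup = solve-∀
    collect : ∀ A a c B → A * a * c + B * c * a ≡ (A + B) * (a * c)
    collect = solve-∀

  S-formula : S * (m ! * m !) * dfact (k ∸ suc m) ≡ A * formula k (A ∸ 1) B m + B * formula k A (B ∸ 1) m
  S-formula = distribute A ((A ∸ 1) C suc m) (B C m) B (A C suc m) ((B ∸ 1) C m) (m ! * m !) (dfact (k ∸ suc m))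
    where
    distribute : ∀ A x c B a y M D → (A * x * c + B * y * a) * M * D ≡ A * (x * c * M * D) + B * (a * y * M * D)
    distribute = solve-∀

  formula-offdiagonal : P * (m ! * m !) * dfact (k ∸ m) ≡ A * formula k (A ∸ 1) B m + B * formula k A (B ∸ 1) m
  formula-offdiagonal with ≤-<-connex k m
  ... | inj₁ k≤m =
    begin
      P * MM * dfact (k ∸ m)
    ≡⟨ cong (λ z → z * MM * dfact (k ∸ m)) (proj₁ vanish) ⟩
      0
    ≡⟨ cong (λ z → z * MM * dfact (k ∸ suc m)) (sym (proj₂ vanish)) ⟩
      S * MM * dfact (k ∸ suc m)
    ≡⟨ S-formula ⟩
      A * formula k (A ∸ 1) B m + B * formula k A (B ∸ 1) m
    ∎
    where
    MM = m ! * m !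
    vanish = too-many-pairs S P k m k≤m S-balance
  ... | inj₂ m<k with m≤n⇒∃[o]m+o≡n m<k
  ... | j , m+1+j≡k =
    begin
      P * MM * dfact (k ∸ m)
    ≡⟨ cong (λ z → P * MM * dfact z) k∸m≡1+j ⟩
      P * MM * dfact (suc j)
    ≡⟨ reorder P MM j (dfact j) ⟩
      suc (2 * j) * P * MM * dfact j
    ≡⟨ cong (λ z → z * MM * dfact j) (sym S≡[2j+1]P) ⟩
      S * MM * dfact j
    ≡⟨ cong (λ z → S * MM * dfact z) (sym k∸m+1≡j) ⟩
      S * MM * dfact (k ∸ suc m)
    ≡⟨ S-formula ⟩
      A * formula k (A ∸ 1) B m + B * formula k A (B ∸ 1) m
    ∎
    where
    MM = m ! * m !
    k∸m≡1+j : k ∸ m ≡ suc j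
    k∸m≡1+j = trans (cong (_∸ m) (trans (sym m+1+j≡k) (sym (+-suc m j)))) (m+n∸m≡n m (suc j))
    k∸m+1≡j : k ∸ suc m ≡ j
    k∸m+1≡j = trans (cong (_∸ suc m) (sym m+1+j≡k)) (m+n∸m≡n (suc m) j)
    reorder : ∀ P M j d → P * M * ((2 * j + 1) * d) ≡ suc (2 * j) * P * M * d
    reorder = solve-∀
    split : ∀ m j P → 2 * (suc m + j) * P ≡ suc (2 * j) * P + suc (2 * m) * P
    split = solve-∀
    S≡[2j+1]P : S ≡ suc (2 * j) * P
    S≡[2j+1]P = +-cancelʳ-≡ (suc (2 * m) * P) S _
      (trans S-balance (trans (cong (λ z → 2 * z * P) (sym m+1+j≡k)) (split m j P)))

open OffDiagonal using (formula-offdiagonal)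

-- The recurrence satisfied by the formula, mirroring the choice of the partner of
-- the lowest point: below w (A ways), at w, or above w (B ways).
formula-recurrence : ∀ k A B m → A + B ≡ 2 * k →
  formula (suc k) (suc A) B m
    ≡ A * formula k (A ∸ 1) B m + falling 0 m * dfact k + B * (formula k A (B ∸ 1) m + Δ m (formula k A (B ∸ 1)))
formula-recurrence k A B m A+B≡2k =
  begin
    formula (suc k) (suc A) B m
  ≡⟨ cong (λ z → z * (B C m) * MM * dfact (k ∸ m)) (pascal A m) ⟩
    (A C m + A C suc m) * (B C m) * MM * dfact (k ∸ m)
  ≡⟨ distribute (A C m) (A C suc m) (B C m) MM (dfact (k ∸ m)) ⟩
    (A C m) * (B C m) * MM * dfact (k ∸ m) + (A C suc m) * (B C m) * MM * dfact (k ∸ m)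
  ≡⟨ cong₂ _+_ (formula-diagonal k A B m) (formula-offdiagonal k A B m A+B≡2k) ⟩
    (falling 0 m * dfact k + B * Δ m (formula k A (B ∸ 1))) + (A * formula k (A ∸ 1) B m + B * formula k A (B ∸ 1) m)
  ≡⟨ regroup (falling 0 m * dfact k) B (Δ m (formula k A (B ∸ 1))) A (formula k (A ∸ 1) B m) (formula k A (B ∸ 1) m) ⟩
    A * formula k (A ∸ 1) B m + falling 0 m * dfact k + B * (formula k A (B ∸ 1) m + Δ m (formula k A (B ∸ 1)))
  ∎
  where
  open ≡-Reasoning
  MM = m ! * m !
  distribute : ∀ a b c M d → (a + b) * c * M * d ≡ a * c * M * d + b * c * M * d
  distribute = solve-∀
  regroup : ∀ z B d A f₁ f₂ → (z + B * d) + (A * f₁ + B * f₂) ≡ A * f₁ + z + B * (f₂ + d)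
  regroup = solve-∀

weight : ℕ → ℕ → Configuration → ℕ
weight m w c = 𝟙≡ (upper c) w * falling (containing c) m

momentAt : ℕ → List ℕ → ℕ → ℕ → ℕ
momentAt k L m w = ∑ (configurationsOf k L) (weight m w)

-- Adding a pair {x < y} below the given pair's lower endpoint raises the count by
-- one exactly when it reaches above w, so the weight grows by 𝟙< w y · Δ.
weight-cons : ∀ m w g h x y r → x < g →
  weight m w ((g , h) , (x , y) ∷ r) ≡ weight m w ((g , h) , r) + 𝟙< w y * Δ m (λ i → weight i w ((g , h) , r))
weight-cons m w g h x y r x<g =
  begin
    𝟙≡ h w * falling (containing ((g , h) , (x , y) ∷ r)) m
  ≡⟨ cong (λ z → 𝟙≡ h w * falling z m) (containing-cons g h x y r x<g) ⟩
    𝟙≡ h w * falling (𝟙< h y + c) m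
  ≡⟨ cong (𝟙≡ h w *_) (falling-bump (𝟙< h y) c m (𝟙<-bit h y)) ⟩
    𝟙≡ h w * (falling c m + 𝟙< h y * Δ m (falling c))
  ≡⟨ 𝟙≡-subst h w (λ v → falling c m + 𝟙< v y * Δ m (falling c)) ⟩
    𝟙≡ h w * (falling c m + 𝟙< w y * Δ m (falling c))
  ≡⟨ distribute (𝟙≡ h w) (falling c m) (𝟙< w y) (Δ m (falling c)) ⟩
    𝟙≡ h w * falling c m + 𝟙< w y * (𝟙≡ h w * Δ m (falling c))
  ≡⟨ cong (λ z → 𝟙≡ h w * falling c m + 𝟙< w y * z) (sym (Δ-*ˡ m (𝟙≡ h w) (falling c))) ⟩
    𝟙≡ h w * falling c m + 𝟙< w y * Δ m (λ i → 𝟙≡ h w * falling c i)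
  ∎
  where
  open ≡-Reasoning
  c = containing ((g , h) , r)
  distribute : ∀ a f b d → a * (f + b * d) ≡ a * f + b * (a * d)
  distribute = solve-∀

-- The configurations of the matching {x < y} ∷ R, with x below all points of R:
-- either {x < y} is the given pair (contained in nothing), or the given pair comes from R.
∑-pick-cons : ∀ m w x y R → All (Both (x <_)) R →
  ∑ (pick ((x , y) ∷ R)) (weight m w)
    ≡ 𝟙≡ y w * falling 0 m + (∑ (pick R) (weight m w) + 𝟙< w y * Δ m (λ i → ∑ (pick R) (weight i w)))
∑-pick-cons m w x y R x<R =
  cong₂ _+_ (cong (λ z → 𝟙≡ y w * falling z m) (containing-min x y R x<R))
    (begin
      ∑ (map _ (pick R)) (weight m w)
    ≡⟨ ∑-map (pick R) _ (weight m w) ⟩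
      ∑ (pick R) (λ { (p , r) → weight m w (p , (x , y) ∷ r) })
    ≡⟨ ∑-congᴬ (All.map (λ { {((g , h) , r)} ((x<g , _) , _) → weight-cons m w g h x y r x<g }) (pick-All R x<R)) ⟩
      ∑ (pick R) (λ c → weight m w c + 𝟙< w y * Δ m (λ i → weight i w c))
    ≡⟨ ∑-+ (pick R) _ _ ⟩
      ∑ (pick R) (weight m w) + ∑ (pick R) (λ c → 𝟙< w y * Δ m (λ i → weight i w c))
    ≡⟨ cong (∑ (pick R) (weight m w) +_) (trans (∑-*ˡ (pick R) (𝟙< w y) _) (cong (𝟙< w y *_) (∑-Δ (pick R) (λ c i → weight i w c) m))) ⟩
      ∑ (pick R) (weight m w) + 𝟙< w y * Δ m (λ i → ∑ (pick R) (weight i w))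
    ∎)
  where open ≡-Reasoning

momentAt-step : ∀ k x xs → All (x <_) xs → ∀ m w →
  momentAt (suc k) (x ∷ xs) m w
    ≡ ∑ (pick xs) (λ yr → 𝟙≡ (proj₁ yr) w * falling 0 m * length (matchingsOf k (proj₂ yr))
                          + momentAt k (proj₂ yr) m w
                          + 𝟙< w (proj₁ yr) * Δ m (λ i → momentAt k (proj₂ yr) i w))
momentAt-step k x xs x<xs m w =
  trans (∑-concatMap (matchingsOf (suc k) (x ∷ xs)) pick (weight m w))
  (trans (∑-concatMap (pick xs) _ _)
         (∑-congᴬ (All.map (λ { {(y , r)} (_ , x<r) → partner y r x<r }) (pick-All xs x<xs))))
  where
  partner : ∀ y r → All (x <_) r →
    ∑ (map ((x , y) ∷_) (matchingsOf k r)) (λ M → ∑ (pick M) (weight m w))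
      ≡ 𝟙≡ y w * falling 0 m * length (matchingsOf k r) + momentAt k r m w + 𝟙< w y * Δ m (λ i → momentAt k r i w)
  partner y r x<r =
    begin
      ∑ (map ((x , y) ∷_) Ms) (λ M → ∑ (pick M) (weight m w))
    ≡⟨ ∑-map Ms ((x , y) ∷_) _ ⟩
      ∑ Ms (λ R → ∑ (pick ((x , y) ∷ R)) (weight m w))
    ≡⟨ ∑-congᴬ (All.map (λ {R} x<R → ∑-pick-cons m w x y R x<R) (matchingsOf-All k r x<r)) ⟩
      ∑ Ms (λ R → a + (∑ (pick R) (weight m w) + 𝟙< w y * Δ m (λ i → ∑ (pick R) (weight i w))))
    ≡⟨ ∑-+ Ms (λ _ → a) _ ⟩
      ∑ Ms (λ _ → a) + ∑ Ms (λ R → ∑ (pick R) (weight m w) + 𝟙< w y * Δ m (λ i → ∑ (pick R) (weight i w)))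
    ≡⟨ cong₂ _+_ (trans (∑-const Ms a) (*-comm (length Ms) a)) (∑-+ Ms _ _) ⟩
      a * length Ms + (∑ Ms (λ R → ∑ (pick R) (weight m w)) + ∑ Ms (λ R → 𝟙< w y * Δ m (λ i → ∑ (pick R) (weight i w))))
    ≡⟨ cong (λ z → a * length Ms + (∑ Ms (λ R → ∑ (pick R) (weight m w)) + z))
            (trans (∑-*ˡ Ms (𝟙< w y) _) (cong (𝟙< w y *_) (∑-Δ Ms (λ R i → ∑ (pick R) (weight i w)) m))) ⟩
      a * length Ms + (∑ Ms (λ R → ∑ (pick R) (weight m w)) + 𝟙< w y * Δ m (λ i → ∑ Ms (λ R → ∑ (pick R) (weight i w))))
    ≡⟨ cong₂ (λ u v → a * length Ms + (u + 𝟙< w y * v))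
             (sym (∑-concatMap Ms pick (weight m w)))
             (Δ-cong m (λ i → sym (∑-concatMap Ms pick (weight i w)))) ⟩
      a * length Ms + (momentAt k r m w + 𝟙< w y * Δ m (λ i → momentAt k r i w))
    ≡⟨ sym (+-assoc (a * length Ms) _ _) ⟩
      a * length Ms + momentAt k r m w + 𝟙< w y * Δ m (λ i → momentAt k r i w)
    ∎
    where
    open ≡-Reasoning
    Ms = matchingsOf k r
    a = 𝟙≡ y w * falling 0 m

#below #at #above : ℕ → List ℕ → ℕ
#below w L = ∑ L (λ y → 𝟙< y w)
#at w L = ∑ L (λ y → 𝟙≡ y w)
#above w L = ∑ L (λ y → 𝟙< w y)

#below-none : ∀ {v w} xs → All (v <_) xs → w ≤ v → #below w xs ≡ 0
#below-none [] [] _ = refl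
#below-none (y ∷ xs) (v<y ∷ v<xs) w≤v rewrite 𝟙<-no (≤-trans w≤v (<⇒≤ v<y)) = #below-none xs v<xs w≤v

#at-none : ∀ {v w} xs → All (v <_) xs → w ≤ v → #at w xs ≡ 0
#at-none [] [] _ = refl
#at-none (y ∷ xs) (v<y ∷ v<xs) w≤v rewrite 𝟙≡-no (>⇒≢ (≤-<-trans w≤v v<y)) = #at-none xs v<xs w≤v

#above-all : ∀ {v} xs → All (v <_) xs → #above v xs ≡ length xs
#above-all [] [] = refl
#above-all (y ∷ xs) (v<y ∷ v<xs) = cong₂ _+_ (𝟙<-yes v<y) (#above-all xs v<xs)

#at-bit : ∀ w L → Increasing L → #at w L ≡ 0 ⊎ #at w L ≡ 1
#at-bit w [] [] = inj₁ refl
#at-bit w (x ∷ xs) (x<xs ∷ inc) with x ≟ w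
... | yes refl rewrite 𝟙≡-refl x | #at-none xs x<xs (≤-refl {x}) = inj₂ refl
... | no x≢w rewrite 𝟙≡-no x≢w = #at-bit w xs inc

#at-member : ∀ L → Increasing L → All (λ z → #at z L ≡ 1) L
#at-member [] [] = []
#at-member (x ∷ xs) (x<xs ∷ inc) =
  cong₂ _+_ (𝟙≡-refl x) (#at-none xs x<xs (≤-refl {x}))
  ∷ All.map (λ { (x<z , e) → cong₂ _+_ (𝟙≡-no (<⇒≢ x<z)) e }) (All.zip (x<xs , #at-member xs inc))

#below+#at+#above : ∀ w L → #below w L + #at w L + #above w L ≡ length L
#below+#at+#above w [] = refl
#below+#at+#above w (y ∷ L) with <-cmp y w
... | tri< y<w _ _ rewrite 𝟙<-yes y<w | 𝟙≡-no (<⇒≢ y<w) | 𝟙<-no (<⇒≤ y<w) =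
  cong suc (#below+#at+#above w L)
... | tri≈ _ refl _ rewrite 𝟙<-no (≤-refl {y}) | 𝟙≡-refl y =
  trans (shift (#below y L) (#at y L) (#above y L)) (cong suc (#below+#at+#above y L))
  where
  shift : ∀ a b c → a + suc b + c ≡ suc (a + b + c)
  shift = solve-∀
... | tri> _ _ w<y rewrite 𝟙<-no (<⇒≤ w<y) | 𝟙≡-no (>⇒≢ w<y) | 𝟙<-yes w<y =
  trans (shift (#below w L) (#at w L) (#above w L)) (cong suc (#below+#at+#above w L))
  where
  shift : ∀ a b c → a + b + suc c ≡ suc (a + b + c)
  shift = solve-∀

-- Summing over the ways to remove one point y from xs: the counts of the rest are
-- those of xs with y's own contribution taken away.  Ψ expresses a summand in
-- terms of the counts with y put back.
∑-pick-counts : ∀ w (xs : List ℕ) (Φ Ψ : ℕ → ℕ → ℕ → ℕ → ℕ) →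
  (∀ y a e g → Ψ y (𝟙< y w + a) (𝟙≡ y w + e) (𝟙< w y + g) ≡ Φ y a e g) →
  ∑ (pick xs) (λ yr → Φ (proj₁ yr) (#below w (proj₂ yr)) (#at w (proj₂ yr)) (#above w (proj₂ yr)))
    ≡ ∑ xs (λ y → Ψ y (#below w xs) (#at w xs) (#above w xs))
∑-pick-counts w [] Φ Ψ put-back = refl
∑-pick-counts w (x ∷ xs) Φ Ψ put-back =
  cong₂ _+_ (sym (put-back x _ _ _))
    (trans (∑-map (pick xs) _ _) (∑-pick-counts w xs Φ′ Ψ′ put-back′))
  where
  Φ′ Ψ′ : ℕ → ℕ → ℕ → ℕ → ℕ
  Φ′ y a e g = Φ y (𝟙< x w + a) (𝟙≡ x w + e) (𝟙< w x + g)
  Ψ′ y a e g = Ψ y (𝟙< x w + a) (𝟙≡ x w + e) (𝟙< w x + g)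
  swap : ∀ a b c → a + (b + c) ≡ b + (a + c)
  swap = solve-∀
  put-back′ : ∀ y a e g → Ψ′ y (𝟙< y w + a) (𝟙≡ y w + e) (𝟙< w y + g) ≡ Φ′ y a e g
  put-back′ y a e g
    rewrite swap (𝟙< x w) (𝟙< y w) a | swap (𝟙≡ x w) (𝟙≡ y w) e | swap (𝟙< w x) (𝟙< w y) g = put-back y _ _ _

∑-by-position : ∀ w xs a b c →
  ∑ xs (λ y → 𝟙< y w * a + 𝟙≡ y w * b + 𝟙< w y * c) ≡ #below w xs * a + #at w xs * b + #above w xs * c
∑-by-position w xs a b c =
  trans (∑-+ xs _ _) (cong₂ _+_ (trans (∑-+ xs _ _) (cong₂ _+_ (∑-*ʳ xs _ a) (∑-*ʳ xs _ b))) (∑-*ʳ xs _ c))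

-- The summand of momentAt-step once the restricted moments of the remaining points
-- are known: i = 𝟙≡ y w and j = 𝟙< w y describe the partner y of the lowest point,
-- and a, e, g are the numbers of remaining points below, at and above w.
partnerValue : ℕ → ℕ → ℕ → ℕ → ℕ → ℕ → ℕ → ℕ
partnerValue k m i j a e g = i * falling 0 m * dfact k + e * formula k a g m + j * (e * Δ m (formula k a g))

partners-without-w : ∀ k m a g →
  a * partnerValue k m 0 0 (a ∸ 1) 0 g + 0 * partnerValue k m 1 0 a (0 ∸ 1) g + g * partnerValue k m 0 1 a 0 (g ∸ 1) ≡ 0
partners-without-w k m a g =
  vanish a (falling 0 m * dfact k) (formula k (a ∸ 1) g m) (Δ m (formula k (a ∸ 1) g)) g (formula k a (g ∸ 1) m) (Δ m (formula k a (g ∸ 1)))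
  where
  vanish : ∀ a z f₁ d₁ g f₂ d₂ → a * (0 * z + 0 * f₁ + 0 * (0 * d₁)) + 0 * (1 * z + 0 * f₁ + 0 * (0 * d₁)) + g * (0 * z + 0 * f₂ + 1 * (0 * d₂)) ≡ 0
  vanish = solve-∀

partners-below-w : ∀ k m a e g → e ≡ 0 ⊎ e ≡ 1 → (e ≡ 1 → a + g ≡ 2 * k) →
  a * partnerValue k m 0 0 (a ∸ 1) e g + e * partnerValue k m 1 0 a (e ∸ 1) g + g * partnerValue k m 0 1 a e (g ∸ 1)
    ≡ e * formula (suc k) (suc a) g m
partners-below-w k m a .0 g (inj₁ refl) _ = partners-without-w k m a g
partners-below-w k m a .1 g (inj₂ refl) a+g≡2k =
  trans (collect a (falling 0 m) (dfact k) (formula k (a ∸ 1) g m) (Δ m (formula k (a ∸ 1) g)) (formula k a 0 m)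
                 (Δ m (formula k a 0)) g (formula k a (g ∸ 1) m) (Δ m (formula k a (g ∸ 1))))
        (cong (1 *_) (sym (formula-recurrence k a g m (a+g≡2k refl))))
  where
  collect : ∀ a z dk f₁ d₁ f₀ d₀ g f₂ d₂ →
    a * (0 * z * dk + 1 * f₁ + 0 * (1 * d₁)) + 1 * (1 * z * dk + 0 * f₀ + 0 * (0 * d₀)) + g * (0 * z * dk + 1 * f₂ + 1 * (1 * d₂))
      ≡ 1 * (a * f₁ + z * dk + g * (f₂ + d₂))
  collect = solve-∀

momentAt-formula : ∀ k L → Increasing L → length L ≡ 2 * k → ∀ m w →
  momentAt k L m w ≡ #at w L * formula k (#below w L) (#above w L) m
momentAt-formula zero [] [] _ m w = refl
momentAt-formula (suc k) (x ∷ xs) (x<xs ∷ inc) len m w =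
  begin
    momentAt (suc k) (x ∷ xs) m w
  ≡⟨ momentAt-step k x xs x<xs m w ⟩
    ∑ (pick xs) (λ yr → 𝟙≡ (proj₁ yr) w * falling 0 m * length (matchingsOf k (proj₂ yr))
                        + momentAt k (proj₂ yr) m w + 𝟙< w (proj₁ yr) * Δ m (λ i → momentAt k (proj₂ yr) i w))
  ≡⟨ ∑-congᴬ (All.map (λ { {(y , r)} (inc-r , len-r) → partner y r inc-r (suc-injective (trans len-r len-xs)) })
                      (All.zip (pick-Increasing xs inc , pick-length xs))) ⟩
    ∑ (pick xs) (λ yr → Φ (proj₁ yr) (#below w (proj₂ yr)) (#at w (proj₂ yr)) (#above w (proj₂ yr)))
  ≡⟨ ∑-pick-counts w xs Φ Ψ put-back ⟩
    ∑ xs (λ y → Ψ y A E B)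
  ≡⟨ ∑-by-position w xs _ _ _ ⟩
    A * partnerValue k m 0 0 (A ∸ 1) E B + E * partnerValue k m 1 0 A (E ∸ 1) B + B * partnerValue k m 0 1 A E (B ∸ 1)
  ≡⟨ lowest-point ⟩
    #at w (x ∷ xs) * formula (suc k) (#below w (x ∷ xs)) (#above w (x ∷ xs)) m
  ∎
  where
  open ≡-Reasoning
  len-xs : length xs ≡ suc (2 * k)
  len-xs = odd-rest k (length xs) len
  A E B : ℕ
  A = #below w xs
  E = #at w xs
  B = #above w xs
  Φ Ψ : ℕ → ℕ → ℕ → ℕ → ℕ
  Φ y a e g = partnerValue k m (𝟙≡ y w) (𝟙< w y) a e g
  Ψ y a e g = 𝟙< y w * partnerValue k m 0 0 (a ∸ 1) e g + 𝟙≡ y w * partnerValue k m 1 0 a (e ∸ 1) g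
              + 𝟙< w y * partnerValue k m 0 1 a e (g ∸ 1)

  partner : ∀ y r → Increasing r → length r ≡ 2 * k →
    𝟙≡ y w * falling 0 m * length (matchingsOf k r) + momentAt k r m w + 𝟙< w y * Δ m (λ i → momentAt k r i w)
      ≡ Φ y (#below w r) (#at w r) (#above w r)
  partner y r inc-r len-r =
    cong₂ _+_ (cong₂ _+_ (cong (𝟙≡ y w * falling 0 m *_) (length-matchingsOf k r len-r))
                         (momentAt-formula k r inc-r len-r m w))
              (cong (𝟙< w y *_) (trans (Δ-cong m (λ i → momentAt-formula k r inc-r len-r i w))
                                       (Δ-*ˡ m (#at w r) (formula k (#below w r) (#above w r)))))

  pick₁ : ∀ X Y Z → 1 * X + 0 * Y + 0 * Z ≡ X
  pick₁ = solve-∀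
  pick₂ : ∀ X Y Z → 0 * X + 1 * Y + 0 * Z ≡ Y
  pick₂ = solve-∀
  pick₃ : ∀ X Y Z → 0 * X + 0 * Y + 1 * Z ≡ Z
  pick₃ = solve-∀

  put-back : ∀ y a e g → Ψ y (𝟙< y w + a) (𝟙≡ y w + e) (𝟙< w y + g) ≡ Φ y a e g
  put-back y a e g with <-cmp y w
  ... | tri< y<w _ _ rewrite 𝟙<-yes y<w | 𝟙≡-no (<⇒≢ y<w) | 𝟙<-no (<⇒≤ y<w) =
    pick₁ (partnerValue k m 0 0 a e g) (partnerValue k m 1 0 (suc a) (e ∸ 1) g) (partnerValue k m 0 1 (suc a) e (g ∸ 1))
  ... | tri≈ _ refl _ rewrite 𝟙<-no (≤-refl {y}) | 𝟙≡-refl y =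
    pick₂ (partnerValue k m 0 0 (a ∸ 1) (suc e) g) (partnerValue k m 1 0 a e g) (partnerValue k m 0 1 a (suc e) (g ∸ 1))
  ... | tri> _ _ w<y rewrite 𝟙<-no (<⇒≤ w<y) | 𝟙≡-no (>⇒≢ w<y) | 𝟙<-yes w<y =
    pick₃ (partnerValue k m 0 0 (a ∸ 1) e (suc g)) (partnerValue k m 1 0 a (e ∸ 1) (suc g)) (partnerValue k m 0 1 a e g)

  lowest-point :
    A * partnerValue k m 0 0 (A ∸ 1) E B + E * partnerValue k m 1 0 A (E ∸ 1) B + B * partnerValue k m 0 1 A E (B ∸ 1)
      ≡ #at w (x ∷ xs) * formula (suc k) (#below w (x ∷ xs)) (#above w (x ∷ xs)) m
  lowest-point with <-cmp x w
  ... | tri< x<w _ _ rewrite 𝟙<-yes x<w | 𝟙≡-no (<⇒≢ x<w) | 𝟙<-no (<⇒≤ x<w) =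
    partners-below-w k m A E B (#at-bit w xs inc) A+B≡2k
    where
    A+B≡2k : E ≡ 1 → A + B ≡ 2 * k
    A+B≡2k E≡1 = suc-injective (trans (shift A B) (trans (cong (λ z → A + z + B) (sym E≡1))
                                                        (trans (#below+#at+#above w xs) len-xs)))
      where
      shift : ∀ a b → suc (a + b) ≡ a + 1 + b
      shift = solve-∀
  ... | tri≈ _ refl _
    rewrite #below-none xs x<xs (≤-refl {x}) | #at-none xs x<xs (≤-refl {x}) | 𝟙≡-refl x | 𝟙<-no (≤-refl {x}) =
    partners-without-w k m 0 B
  ... | tri> _ _ w<x
    rewrite 𝟙<-no (<⇒≤ w<x) | 𝟙≡-no (>⇒≢ w<x) | 𝟙<-yes w<x | #below-none xs x<xs (<⇒≤ w<x) | #at-none xs x<xs (<⇒≤ w<x) =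
    partners-without-w k m 0 B

moment : ℕ → List ℕ → ℕ → ℕ
moment k L m = ∑ (configurationsOf k L) (λ c → falling (containing c) m)

moment-by-upper : ∀ k L → Increasing L → ∀ m → moment k L m ≡ ∑ L (momentAt k L m)
moment-by-upper k L inc m = sym (trans (∑-comm L (configurationsOf k L) _)
  (∑-congᴬ (All.map (λ {c} at≡1 →
       begin
         ∑ L (λ w → 𝟙≡ (upper c) w * falling (containing c) m)
       ≡⟨ ∑-cong L (λ w → cong (_* falling (containing c) m) (𝟙≡-sym (upper c) w)) ⟩
         ∑ L (λ w → 𝟙≡ w (upper c) * falling (containing c) m)
       ≡⟨ ∑-*ʳ L (λ w → 𝟙≡ w (upper c)) _ ⟩
         #at (upper c) L * falling (containing c) m
       ≡⟨ cong (_* falling (containing c) m) at≡1 ⟩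
         1 * falling (containing c) m
       ≡⟨ *-identityˡ _ ⟩
         falling (containing c) m
       ∎)
    (configurationsOf-upper k L (#at-member L inc)))))
  where open ≡-Reasoning

position-lowest : ∀ x xs → All (x <_) xs → (f : ℕ → ℕ → ℕ) →
  #at x (x ∷ xs) * f (#below x (x ∷ xs)) (#above x (x ∷ xs)) ≡ f 0 (length xs)
position-lowest x xs x<xs f
  rewrite 𝟙≡-refl x | 𝟙<-no (≤-refl {x}) | #at-none xs x<xs (≤-refl {x})
        | #below-none xs x<xs (≤-refl {x}) | #above-all xs x<xs = +-identityʳ _

position-shift : ∀ x xs {w} → x < w → (f : ℕ → ℕ → ℕ) →
  #at w (x ∷ xs) * f (#below w (x ∷ xs)) (#above w (x ∷ xs)) ≡ #at w xs * f (suc (#below w xs)) (#above w xs)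
position-shift x xs x<w f rewrite 𝟙≡-no (<⇒≢ x<w) | 𝟙<-yes x<w | 𝟙<-no (<⇒≤ x<w) = refl

-- Hence in an increasing list the point in position a has a points below it and
-- the rest above it.
∑-positions : ∀ x xs → Increasing (x ∷ xs) → (f : ℕ → ℕ → ℕ) →
  ∑ (x ∷ xs) (λ w → #at w (x ∷ xs) * f (#below w (x ∷ xs)) (#above w (x ∷ xs))) ≡ ∑⟨ length xs ⟩ f
∑-positions x [] ([] ∷ []) f = trans (+-identityʳ _) (position-lowest x [] [] f)
∑-positions x (y ∷ ys) (x<xs ∷ inc) f =
  cong₂ _+_ (position-lowest x (y ∷ ys) x<xs f)
    (trans (∑-congᴬ (All.map (λ x<w → position-shift x (y ∷ ys) x<w f) x<xs))
           (∑-positions y ys inc (λ a b → f (suc a) b)))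

moment-formula : ∀ k L → Increasing L → length L ≡ 2 * suc k → ∀ m →
  moment (suc k) L m ≡ ((2 * suc k) C (2 * suc m)) * (m ! * m !) * dfact (k ∸ m)
moment-formula k (x ∷ xs) inc len m =
  begin
    moment (suc k) (x ∷ xs) m
  ≡⟨ moment-by-upper (suc k) (x ∷ xs) inc m ⟩
    ∑ (x ∷ xs) (momentAt (suc k) (x ∷ xs) m)
  ≡⟨ ∑-cong (x ∷ xs) (momentAt-formula (suc k) (x ∷ xs) inc len m) ⟩
    ∑ (x ∷ xs) (λ w → #at w (x ∷ xs) * formula (suc k) (#below w (x ∷ xs)) (#above w (x ∷ xs)) m)
  ≡⟨ ∑-positions x xs inc (λ a b → formula (suc k) a b m) ⟩
    ∑⟨ length xs ⟩ (λ a b → (a C suc m) * (b C m) * MM * D)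
  ≡⟨ ∑⟨⟩-*ʳ (length xs) (λ a b → (a C suc m) * (b C m) * MM) D ⟩
    ∑⟨ length xs ⟩ (λ a b → (a C suc m) * (b C m) * MM) * D
  ≡⟨ cong (_* D) (∑⟨⟩-*ʳ (length xs) (λ a b → (a C suc m) * (b C m)) MM) ⟩
    ∑⟨ length xs ⟩ (λ a b → (a C suc m) * (b C m)) * MM * D
  ≡⟨ cong (λ z → z * MM * D) (vandermonde-upper (length xs) (suc m) m) ⟩
    (suc (length xs) C suc (suc m + m)) * MM * D
  ≡⟨ cong₂ (λ u v → (u C v) * MM * D) len (double-suc m) ⟩
    ((2 * suc k) C (2 * suc m)) * MM * D
  ∎
  where
  open ≡-Reasoning
  MM = m ! * m !
  D = dfact (k ∸ m)
  double-suc : ∀ m → suc (suc m + m) ≡ 2 * suc m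
  double-suc = solve-∀

points-increasing : ∀ n → Increasing (points n)
points-increasing n = AllPairs.map⁺ (AllPairs.applyUpTo⁺₁ (λ i → i) (2 * n) (λ i<j _ → s<s i<j))

length-points : ∀ n → length (points n) ≡ 2 * n
length-points n = trans (List.length-map suc (upTo (2 * n))) (List.length-upTo (2 * n))

moment-points : ∀ k m →
  (m + 1) * dfact (m + 1) * moment (suc k) (points (suc k)) m ≡ total (suc k) * (falling k m * m !)
moment-points k m =
  begin
    (m + 1) * dfact (m + 1) * moment n (points n) m
  ≡⟨ cong₂ (λ u v → u * dfact u * v) (+-comm m 1) (moment-formula k (points n) (points-increasing n) (length-points n) m) ⟩
    suc m * dfact (suc m) * (Cb * (m ! * m !) * D)
  ≡⟨ reorder₁ (suc m) (dfact (suc m)) Cb (m !) D ⟩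
    m ! * (suc m * m !) * (Cb * dfact (suc m) * D)
  ≡⟨ cong (m ! * (suc m * m !) *_) (binom-double n (suc m)) ⟩
    m ! * (suc m * m !) * ((n C suc m) * dfact n)
  ≡⟨ reorder₂ (m !) (suc m) (n C suc m) (dfact n) ⟩
    m ! * dfact n * (suc m ! * (n C suc m))
  ≡⟨ cong (m ! * dfact n *_) (falling≡!*C n (suc m)) ⟩
    m ! * dfact n * (n * falling k m)
  ≡⟨ reorder₃ (m !) (dfact n) n (falling k m) ⟩
    n * dfact n * (falling k m * m !)
  ∎
  where
  open ≡-Reasoning
  n = suc k
  Cb = (2 * n) C (2 * suc m)
  D = dfact (k ∸ m)
  reorder₁ : ∀ s d c f D → s * d * (c * (f * f) * D) ≡ f * (s * f) * (c * d * D)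
  reorder₁ = solve-∀
  reorder₂ : ∀ f s c d → f * (s * f) * (c * d) ≡ f * d * (s * f * c)
  reorder₂ = solve-∀
  reorder₃ : ∀ f d n x → f * d * (n * x) ≡ n * d * (x * f)
  reorder₃ = solve-∀

∑-upTo-suc : ∀ n (h : ℕ → ℕ) → ∑ (upTo (suc n)) h ≡ h 0 + ∑ (upTo n) (λ p → h (suc p))
∑-upTo-suc n h =
  cong (h 0 +_) (trans (cong (λ L → ∑ L h) (sym (List.map-applyUpTo (λ i → i) suc n))) (∑-map (upTo n) suc h))

∑-𝟙≡ : ∀ n (h : ℕ → ℕ) c → ∑ (upTo n) (λ p → h p * 𝟙≡ c p) ≡ 𝟙< c n * h c
∑-𝟙≡ zero h c = refl
∑-𝟙≡ (suc n) h zero =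
  begin
    ∑ (upTo (suc n)) (λ p → h p * 𝟙≡ 0 p)
  ≡⟨ ∑-upTo-suc n _ ⟩
    h 0 * 1 + ∑ (upTo n) (λ p → h (suc p) * 0)
  ≡⟨ cong₂ _+_ (*-identityʳ (h 0)) (trans (∑-cong (upTo n) (λ p → *-zeroʳ (h (suc p)))) (∑-zero (upTo n))) ⟩
    h 0 + 0
  ≡⟨ +-identityʳ (h 0) ⟩
    h 0
  ≡⟨ sym (*-identityˡ (h 0)) ⟩
    1 * h 0
  ∎
  where open ≡-Reasoning
∑-𝟙≡ (suc n) h (suc c) =
  trans (∑-upTo-suc n _) (cong₂ _+_ (*-zeroʳ (h 0)) (∑-𝟙≡ n (λ p → h (suc p)) c))

length-filter-cons : {A : Set} (v : A → ℕ) (c : A) (cs : List A) (p : ℕ) →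
  length (filter (λ x → v x ≟ p) (c ∷ cs)) ≡ 𝟙≡ (v c) p + length (filter (λ x → v x ≟ p) cs)
length-filter-cons v c cs p with v c ≟ p
... | yes vc≡p rewrite List.filter-accept (λ x → v x ≟ p) {c} {cs} vc≡p | vc≡p | 𝟙≡-refl p = refl
... | no vc≢p rewrite List.filter-reject (λ x → v x ≟ p) {c} {cs} vc≢p | 𝟙≡-no vc≢p = refl

∑-fibres : {A : Set} (v : A → ℕ) (n : ℕ) (f : ℕ → ℕ) (cs : List A) → All (λ c → v c < n) cs →
  ∑ (upTo n) (λ p → f p * length (filter (λ c → v c ≟ p) cs)) ≡ ∑ cs (λ c → f (v c))
∑-fibres v n f [] [] = trans (∑-cong (upTo n) (λ p → *-zeroʳ (f p))) (∑-zero (upTo n))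
∑-fibres v n f (c ∷ cs) (vc<n ∷ v<n) =
  begin
    ∑ (upTo n) (λ p → f p * length (filter (λ x → v x ≟ p) (c ∷ cs)))
  ≡⟨ ∑-cong (upTo n) (λ p → trans (cong (f p *_) (length-filter-cons v c cs p)) (*-distribˡ-+ (f p) _ _)) ⟩
    ∑ (upTo n) (λ p → f p * 𝟙≡ (v c) p + f p * length (filter (λ x → v x ≟ p) cs))
  ≡⟨ ∑-+ (upTo n) _ _ ⟩
    ∑ (upTo n) (λ p → f p * 𝟙≡ (v c) p) + ∑ (upTo n) (λ p → f p * length (filter (λ x → v x ≟ p) cs))
  ≡⟨ cong₂ _+_ (trans (∑-𝟙≡ n f (v c)) (trans (cong (_* f (v c)) (𝟙<-yes vc<n)) (+-identityʳ _))) (∑-fibres v n f cs v<n) ⟩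
    f (v c) + ∑ cs (λ x → f (v x))
  ∎
  where open ≡-Reasoning

factorialMoment : ℕ → ℕ → ℕ
factorialMoment n m = sumTo n (λ p → falling p m * G n p)

factorialMoment≡moment : ∀ n m → factorialMoment n m ≡ moment n (points n) m
factorialMoment≡moment n m =
  trans (sum-map (upTo n) _) (∑-fibres containing n (λ p → falling p m) (configurations n) (containing-bound n (points n)))

factorial-moments : ∀ k m →
  (m + 1) * dfact (m + 1) * factorialMoment (suc k) m ≡ total (suc k) * (falling k m * m !)
factorial-moments k m =
  trans (cong ((m + 1) * dfact (m + 1) *_) (factorialMoment≡moment (suc k) m)) (moment-points k m)

mean-identity : ∀ k → 6 * factorialMoment (suc k) 1 ≡ total (suc k) * k
mean-identity k = trans (factorial-moments k 1) (cong (total (suc k) *_) (trans (*-identityʳ _) (falling-one k)))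

sumTo-cong : ∀ n {f g : ℕ → ℕ} → (∀ p → f p ≡ g p) → sumTo n f ≡ sumTo n g
sumTo-cong n e = cong sum (List.map-cong e (upTo n))

sumTo-+ : ∀ n (f g : ℕ → ℕ) → sumTo n (λ p → f p + g p) ≡ sumTo n f + sumTo n g
sumTo-+ n f g =
  trans (sum-map (upTo n) _) (trans (∑-+ (upTo n) f g) (sym (cong₂ _+_ (sum-map (upTo n) f) (sum-map (upTo n) g))))

first-moment : ∀ n → sumTo n (λ p → p * G n p) ≡ factorialMoment n 1
first-moment n = sumTo-cong n (λ p → cong (_* G n p) (sym (falling-one p)))

second-moment : ∀ n → sumTo n (λ p → p * p * G n p) ≡ factorialMoment n 2 + factorialMoment n 1
second-moment n =
  trans (sumTo-cong n (λ p → trans (cong (_* G n p) (sym (falling-two p))) (*-distribʳ-+ (G n p) (falling p 2) (falling p 1))))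
        (sumTo-+ n (λ p → falling p 2 * G n p) (λ p → falling p 1 * G n p))

variance-arithmetic : ∀ k T M₁ M₂ → 6 * M₁ ≡ T * k → 45 * M₂ ≡ T * (falling k 2 * 2) →
  180 * (T * (M₂ + M₁)) ≡ 180 * (M₁ * M₁) + k * (3 * suc k + 19) * (T * T)
variance-arithmetic k T M₁ M₂ mean second =
  begin
    180 * (T * (M₂ + M₁))
  ≡⟨ split T M₂ M₁ ⟩
    4 * T * (45 * M₂) + 30 * T * (6 * M₁)
  ≡⟨ cong₂ (λ u v → 4 * T * u + 30 * T * v) second mean ⟩
    4 * T * (T * (falling k 2 * 2)) + 30 * T * (T * k)
  ≡⟨ regroup T (falling k 2) k ⟩
    8 * (falling k 2 + k) * (T * T) + 22 * k * (T * T)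
  ≡⟨ cong (λ z → 8 * z * (T * T) + 22 * k * (T * T)) (trans (cong (λ z → falling k 2 + z) (sym (falling-one k))) (falling-two k)) ⟩
    8 * (k * k) * (T * T) + 22 * k * (T * T)
  ≡⟨ complete-square k T ⟩
    5 * (T * k) * (T * k) + k * (3 * suc k + 19) * (T * T)
  ≡⟨ cong (λ z → 5 * z * z + k * (3 * suc k + 19) * (T * T)) (sym mean) ⟩
    5 * (6 * M₁) * (6 * M₁) + k * (3 * suc k + 19) * (T * T)
  ≡⟨ cong (_+ k * (3 * suc k + 19) * (T * T)) (square M₁) ⟩
    180 * (M₁ * M₁) + k * (3 * suc k + 19) * (T * T)
  ∎
  where
  open ≡-Reasoning
  split : ∀ T a b → 180 * (T * (a + b)) ≡ 4 * T * (45 * a) + 30 * T * (6 * b)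
  split = solve-∀
  regroup : ∀ T f k → 4 * T * (T * (f * 2)) + 30 * T * (T * k) ≡ 8 * (f + k) * (T * T) + 22 * k * (T * T)
  regroup = solve-∀
  complete-square : ∀ k T → 8 * (k * k) * (T * T) + 22 * k * (T * T) ≡ 5 * (T * k) * (T * k) + k * (3 * suc k + 19) * (T * T)
  complete-square = solve-∀
  square : ∀ M → 5 * (6 * M) * (6 * M) ≡ 180 * (M * M)
  square = solve-∀

-- The variance is stated in ℤ.  These imports come only here because the integer
-- constructor +_ makes the sections (x +_) used above ambiguous.
open import Data.Integer using (+_) renaming (_*_ to _*ℤ_; _-_ to _-ℤ_; _+_ to _+ℤ_)
open import Data.Integer.Properties using (pos-*; pos-+)
import Data.Integer.Tactic.RingSolver as ℤ-Solver

ℤ-difference : ∀ c X Y W → c * X ≡ c * Y + W → + c *ℤ (+ X -ℤ + Y) ≡ + W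
ℤ-difference c X Y W e =
  begin
    + c *ℤ (+ X -ℤ + Y)
  ≡⟨ distribute (+ c) (+ X) (+ Y) ⟩
    + c *ℤ + X -ℤ + c *ℤ + Y
  ≡⟨ cong₂ _-ℤ_ (sym (pos-* c X)) (sym (pos-* c Y)) ⟩
    + (c * X) -ℤ + (c * Y)
  ≡⟨ cong (λ z → + z -ℤ + (c * Y)) e ⟩
    + (c * Y + W) -ℤ + (c * Y)
  ≡⟨ cong (_-ℤ + (c * Y)) (pos-+ (c * Y) W) ⟩
    (+ (c * Y) +ℤ + W) -ℤ + (c * Y)
  ≡⟨ cancel (+ (c * Y)) (+ W) ⟩
    + W
  ∎
  where
  open ≡-Reasoning
  distribute : ∀ c x y → c *ℤ (x -ℤ y) ≡ c *ℤ x -ℤ c *ℤ y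
  distribute = ℤ-Solver.solve-∀
  cancel : ∀ a b → (a +ℤ b) -ℤ a ≡ b
  cancel = ℤ-Solver.solve-∀

lemma19 : (n : ℕ) → 1 ≤ n →
    ((m : ℕ) →
      (m + 1) * dfact (m + 1) * (sumTo n λ p → falling p m * G n p)
        ≡ total n * (falling (n ∸ 1) m * m !))
    × (6 * (sumTo n λ p → p * G n p) ≡ (n ∸ 1) * total n)
    × (+ 180 *ℤ (+ total n *ℤ + (sumTo n λ p → p * p * G n p)
                  -ℤ + (sumTo n λ p → p * G n p) *ℤ + (sumTo n λ p → p * G n p))
        ≡ + ((n ∸ 1) * (3 * n + 19) * (total n * total n)))
lemma19 (suc k) _ = factorial-moments k , mean , variance
  where
  Tₙ M₁ M₂ S₁ S₂ : ℕ
  Tₙ = total (suc k)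
  M₁ = factorialMoment (suc k) 1
  M₂ = factorialMoment (suc k) 2
  S₁ = sumTo (suc k) (λ p → p * G (suc k) p)
  S₂ = sumTo (suc k) (λ p → p * p * G (suc k) p)

  mean : 6 * S₁ ≡ k * Tₙ
  mean = trans (cong (6 *_) (first-moment (suc k))) (trans (mean-identity k) (*-comm Tₙ k))

  variance-ℕ : 180 * (Tₙ * S₂) ≡ 180 * (S₁ * S₁) + k * (3 * suc k + 19) * (Tₙ * Tₙ)
  variance-ℕ =
    trans (cong (λ z → 180 * (Tₙ * z)) (second-moment (suc k)))
      (trans (variance-arithmetic k Tₙ M₁ M₂ (mean-identity k) (factorial-moments k 2))
             (cong (λ z → 180 * (z * z) + k * (3 * suc k + 19) * (Tₙ * Tₙ)) (sym (first-moment (suc k)))))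

  variance : + 180 *ℤ (+ Tₙ *ℤ + S₂ -ℤ + S₁ *ℤ + S₁) ≡ + (k * (3 * suc k + 19) * (Tₙ * Tₙ))
  variance = trans (cong₂ (λ u v → + 180 *ℤ (u -ℤ v)) (sym (pos-* Tₙ S₂)) (sym (pos-* S₁ S₁)))
                   (ℤ-difference 180 (Tₙ * S₂) (S₁ * S₁) _ variance-ℕ)
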